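{- Let $k\ge1$, let $\mathcal{A}_k$ be the set of $k$-atoms, and let $\mathcal{B}_k$ be the set of those $k$-atoms that are not $Tr_k^{(v,e)}$-critical or do not have transitivity equal to $k$. A graph $G$ with $n$ vertices is $Tr_k^{e}$-critical if and only if $G=H\cup\overline{K}_{n-n_H}$ (disjoint union), where $H\in\mathcal{A}_k'=\mathcal{A}_k\setminus\mathcal{B}_k$ and $n_H$ is the number of vertices of $H$.
   Context: All graphs are finite and simple; $\overline{K}_m$ is the edgeless graph on $m$ vertices. For disjoint $A,B\subseteq V$, $A$ dominates $B$ if every vertex of $B$ is adjacent to at least one vertex of $A$. A transitive $k$-partition of $G=(V,E)$ is a partition $\{V_1,\dots,V_k\}$ of $V$ into $k$ nonempty parts such that $V_i$ dominates $V_j$ for all $1\le i<j\le k$; the transitivity $Tr(G)$ is the maximum such $k$. $G$ is transitively edge critical if deleting any edge yields a graph of transitivity less than $Tr(G)$; with $Tr(G)=k$ it is $Tr_k^{e}$-critical. $G$ is transitively vertex-edge critical if deleting any element of $V\cup E$ (deleting a vertex removes it with its incident edges) yields a graph of transitivity less than $Tr(G)$; with $Tr(G)=k$ it is $Tr_k^{(v,e)}$-critical. $t$-atoms are defined recursively: the only $1$-atom is $K_1$; if $H=(V,E)$ is a $(t-1)$-atom with $n$ vertices, choose $r\in\{1,\dots,n\}$, a set $I_r$ of $r$ new independent vertices and an $r$-subset $W\subseteq V$, add a perfect matching between $I_r$ and $W$, and join each vertex of $V\setminus W$ by an edge to exactly one (arbitrary) vertex of $I_r$; every graph so obtained is a $t$-atom.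 Membership in $\mathcal{A}_k$ is up to isomorphism. -}

module Defs where

open import Data.Nat using (ℕ; zero; suc; _+_; _<_; _≤_)
open import Data.Fin as Fin using (Fin; splitAt; punchIn; _≟_)
open import Data.Fin.Properties using (any?)
open import Data.Bool using (Bool; true; false; _∧_; _∨_; not)
open import Data.Sum using (_⊎_; inj₁; inj₂)
open import Data.Product using (Σ; ∃; ∃-syntax; _×_; _,_)
open import Data.Unit using (⊤)
open import Relation.Nullary using (¬_)
open import Relation.Nullary.Decidable using (⌊_⌋)
open import Relation.Binary.PropositionalEquality using (_≡_; _≢_)
open import Function.Bundles using (_↔_; Inverse)
open import Function.Definitions using (Injective)

Graph : ℕ → Set
Graph n = Fin n → Fin n → Bool

Simple : ∀ {n} → Graph n → Set
Simple {n} G = (∀ (u v : Fin n) → G u v ≡ G v u) × (∀ (v : Fin n) → G v v ≡ false)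

Adj : ∀ {n} → Graph n → Fin n → Fin n → Set
Adj G u v = G u v ≡ true

_≅_ : ∀ {n m} → Graph n → Graph m → Set
_≅_ {n} {m} G H = Σ (Fin n ↔ Fin m) λ σ →
  ∀ u v → G u v ≡ H (Inverse.to σ u) (Inverse.to σ v)

-- A transitive k-partition: p assigns each vertex its part in Fin k;
-- every part is nonempty, and V_i dominates V_j for all i < j.
TransitivePartition : ∀ {n} → Graph n → (k : ℕ) → (Fin n → Fin k) → Set
TransitivePartition {n} G k p =
  (∀ (j : Fin k) → ∃[ v ] p v ≡ j) ×
  (∀ (v : Fin n) (i : Fin k) → i Fin.< p v → ∃[ u ] (p u ≡ i × Adj G u v))

HasTP : ∀ {n} → Graph n → ℕ → Set
HasTP {n} G k = Σ (Fin n → Fin k) (TransitivePartition G k)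

IsTr : ∀ {n} → Graph n → ℕ → Set
IsTr G k = HasTP G k × (∀ m → HasTP G m → m ≤ k)

TrBelow : ∀ {n} → Graph n → ℕ → Set
TrBelow G k = ∀ m → HasTP G m → m < k

deleteEdge : ∀ {n} → Graph n → Fin n → Fin n → Graph n
deleteEdge G a b x y =
  G x y ∧ not ((⌊ x ≟ a ⌋ ∧ ⌊ y ≟ b ⌋) ∨ (⌊ x ≟ b ⌋ ∧ ⌊ y ≟ a ⌋))

deleteVertex : ∀ {m} → Graph (suc m) → Fin (suc m) → Graph m
deleteVertex G v x y = G (punchIn v x) (punchIn v y)

EdgeCritical : ∀ {n} → Graph n → ℕ → Set
EdgeCritical {n} G k = ∀ (a b : Fin n) → Adj G a b → TrBelow (deleteEdge G a b) k

VertexCritical : ∀ {n} → Graph n → ℕ → Set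
VertexCritical {zero} G k = ⊤
VertexCritical {suc m} G k = ∀ (v : Fin (suc m)) → TrBelow (deleteVertex G v) k

TrECritical : ∀ {n} → Graph n → ℕ → Set
TrECritical G k = IsTr G k × EdgeCritical G k

TrVECritical : ∀ {n} → Graph n → ℕ → Set
TrVECritical G k = IsTr G k × EdgeCritical G k × VertexCritical G k

edgeless : (m : ℕ) → Graph m
edgeless m _ _ = false

unionEdgeless : ∀ {n} → Graph n → (p : ℕ) → Graph (n + p)
unionEdgeless {n} H p x y with splitAt n x | splitAt n y
... | inj₁ u | inj₁ v = H u v
... | _      | _      = false

-- One atom step: H on Fin n, new independent vertices Fin r;
-- w : perfect matching of I_r onto W = image w (w injective);
-- f : each vertex of V ∖ W is joined to exactly the new vertex f v.
stepCross : ∀ {n r} → (Fin r → Fin n) → (Fin n → Fin r) → Fin n → Fin r → Bool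
stepCross {n} {r} w f v i =
  ⌊ w i ≟ v ⌋ ∨ (not ⌊ any? (λ j → w j ≟ v) ⌋ ∧ ⌊ f v ≟ i ⌋)

atomStep : ∀ {n} → Graph n → (r : ℕ) → (Fin r → Fin n) → (Fin n → Fin r) → Graph (n + r)
atomStep {n} H r w f x y with splitAt n x | splitAt n y
... | inj₁ u | inj₁ v = H u v
... | inj₁ u | inj₂ j = stepCross w f u j
... | inj₂ i | inj₁ v = stepCross w f v i
... | inj₂ i | inj₂ j = false

data AtomC : (t : ℕ) → ∀ {n} → Graph n → Set where
  atom₁ : AtomC 1 (edgeless 1)
  atomₛ : ∀ {t n} {H : Graph n} → AtomC t H →
          (r : ℕ) → 1 ≤ r → (w : Fin r → Fin n) → Injective _≡_ _≡_ w →
          (f : Fin n → Fin r) →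
          AtomC (suc t) (atomStep H r w f)

IsAtom : (t : ℕ) → ∀ {n} → Graph n → Set
IsAtom t {n} G = Σ (Graph n) λ H → AtomC t H × G ≅ H

IsAtom' : (k : ℕ) → ∀ {n} → Graph n → Set
IsAtom' k G = IsAtom k G × TrVECritical G k

{-# OPTIONS --safe #-}
-- A transitive k-partition contains a k-atom: start from a vertex of the last part and
-- repeatedly add, for the vertices collected so far, their dominators in the preceding part.
-- If G is Tr_k^e-critical, every edge of G outside such an atom A could be deleted without
-- destroying A, so G is A together with isolated vertices.  A inherits edge-criticality, and
-- deleting a vertex of A (which has a neighbour when k ≥ 2) is no worse than deleting an edge
-- at it.
module Submission where

open import Defs
open import Data.Bool using (true; false; _∧_; not)
open import Data.Bool.Properties using (⇔→≡; ∨-zeroʳ; ∧-zeroʳ) renaming (_≟_ to _≟ᵇ_)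
open import Data.Empty using (⊥-elim)
open import Data.Fin as Fin using (Fin; zero; suc; toℕ; fromℕ<; splitAt; _↑ˡ_; _↑ʳ_; punchIn; _≟_)
open import Data.Fin.Properties
  using (any?; splitAt-↑ˡ; splitAt-↑ʳ; splitAt⁻¹-↑ˡ; splitAt⁻¹-↑ʳ; +↔⊎; ↑ˡ-injective;
         suc-injective; punchInᵢ≢i; punchIn-injective; toℕ-fromℕ<; toℕ<n)
open import Data.Nat using (ℕ; zero; suc; _+_; _≤_; _<_; z≤n; s≤s)
open import Data.Nat.Properties
  using (m+n≤o⇒n≤o; ≤-trans; ≤-reflexive; <-irrefl; +-suc; +-identityʳ; n≤1+n; n≮0)
open import Data.Product using (Σ; ∃₂; ∃-syntax; _×_; _,_; proj₁; proj₂)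
import Data.Product as Product
open import Data.Sum using (_⊎_; inj₁; inj₂; [_,_]′)
import Data.Sum as Sum
open import Data.Unit using (tt)
open import Data.Vec.Functional using (_++_)
open import Data.Vec.Functional.Properties using (lookup-++ˡ; lookup-++ʳ)
open import Function.Base using (_∘_; const)
open import Function.Bundles using (_↔_; _⇔_; Inverse; mk⇔; mk↔ₛ′)
open import Function.Construct.Composition using (_↔-∘_)
open import Function.Construct.Identity using (↔-id)
open import Function.Construct.Symmetry using (↔-sym)
open import Function.Definitions using (Injective)
open import Relation.Nullary using (¬_; Dec; does; yes; no; ¬?; _×-dec_; _⊎-dec_)
open import Relation.Nullary.Decidable using (dec-false; isYes≗does)
open import Relation.Binary.PropositionalEquality
  using (_≡_; _≢_; refl; sym; trans; cong; cong₂; subst; subst₂)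

data SplitView (m n : ℕ) : Fin (m + n) → Set where
  left  : (u : Fin m) → SplitView m n (u ↑ˡ n)
  right : (i : Fin n) → SplitView m n (m ↑ʳ i)

splitView : ∀ m {n} (x : Fin (m + n)) → SplitView m n x
splitView m x with splitAt m x in eq
... | inj₁ u = subst (SplitView m _) (splitAt⁻¹-↑ˡ eq) (left u)
... | inj₂ i = subst (SplitView m _) (splitAt⁻¹-↑ʳ eq) (right i)

++-injective : ∀ {m n p} {φ : Fin m → Fin p} {ψ : Fin n → Fin p} →
               Injective _≡_ _≡_ φ → Injective _≡_ _≡_ ψ → (∀ u i → φ u ≢ ψ i) → Injective _≡_ _≡_ (φ ++ ψ)
++-injective {m} {n} {φ = φ} {ψ} φ-injective ψ-injective disjoint {x} {y} eq with splitView m x | splitView m y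
... | left u  | left v  =
  cong (_↑ˡ n) (φ-injective (trans (sym (lookup-++ˡ φ ψ u)) (trans eq (lookup-++ˡ φ ψ v))))
... | left u  | right j =
  ⊥-elim (disjoint u j (trans (sym (lookup-++ˡ φ ψ u)) (trans eq (lookup-++ʳ φ ψ j))))
... | right i | left v  =
  ⊥-elim (disjoint v i (trans (sym (lookup-++ˡ φ ψ v)) (trans (sym eq) (lookup-++ʳ φ ψ i))))
... | right i | right j =
  cong (m ↑ʳ_) (ψ-injective (trans (sym (lookup-++ʳ φ ψ i)) (trans eq (lookup-++ʳ φ ψ j))))

record Enumeration {n} (P : Fin n → Set) : Set where
  field
    size           : ℕ
    enum           : Fin size → Fin n
    enum-injective : Injective _≡_ _≡_ enum
    enum-sound     : ∀ i → P (enum i)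
    enum-complete  : ∀ {x} → P x → ∃[ i ] enum i ≡ x

enumerate : ∀ {n} {P : Fin n → Set} → (∀ x → Dec (P x)) → Enumeration P
enumerate {zero} P? = record
  { size = 0 ; enum = λ () ; enum-injective = λ { {()} } ; enum-sound = λ () ; enum-complete = λ { {()} } }
enumerate {suc n} {P} P? with enumerate (P? ∘ suc) | P? zero
... | E | no ¬P0 = record
  { size = size ; enum = suc ∘ enum ; enum-injective = enum-injective ∘ suc-injective
  ; enum-sound = enum-sound ; enum-complete = complete }
  where
  open Enumeration E
  complete : ∀ {x} → P x → ∃[ i ] suc (enum i) ≡ x
  complete {zero} P0 = ⊥-elim (¬P0 P0)
  complete {suc x} Px = Product.map₂ (cong suc) (enum-complete Px)
... | E | yes P0 = record
  { size = suc size ; enum = enum′ ; enum-injective = injective ; enum-sound = sound ; enum-complete = complete }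
  where
  open Enumeration E
  enum′ : Fin (suc size) → Fin (suc n)
  enum′ zero    = zero
  enum′ (suc i) = suc (enum i)
  injective : Injective _≡_ _≡_ enum′
  injective {zero}  {zero}  _  = refl
  injective {suc i} {suc j} eq = cong suc (enum-injective (suc-injective eq))
  sound : ∀ i → P (enum′ i)
  sound zero    = P0
  sound (suc i) = enum-sound i
  complete : ∀ {x} → P x → ∃[ i ] enum′ i ≡ x
  complete {zero}  _  = zero , refl
  complete {suc x} Px = Product.map suc (cong suc) (enum-complete Px)

record ImageFactorization {a n} (g : Fin a → Fin n) : Set where
  field
    size           : ℕ
    enum           : Fin size → Fin n
    enum-injective : Injective _≡_ _≡_ enum
    index          : Fin a → Fin size
    enum∘index     : ∀ u → enum (index u) ≡ g u
    pick           : Fin size → Fin a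
    index∘pick     : ∀ i → index (pick i) ≡ i

imageFactorization : ∀ {a n} (g : Fin a → Fin n) → ImageFactorization g
imageFactorization g = record
  { size = size ; enum = enum ; enum-injective = enum-injective
  ; index = index ; enum∘index = enum∘index ; pick = pick ; index∘pick = index∘pick }
  where
  open Enumeration (enumerate (λ y → any? (λ u → g u ≟ y)))
  index : Fin _ → Fin size
  index u = proj₁ (enum-complete (u , refl))
  enum∘index : ∀ u → enum (index u) ≡ g u
  enum∘index u = proj₂ (enum-complete (u , refl))
  pick : Fin size → Fin _
  pick i = proj₁ (enum-sound i)
  index∘pick : ∀ i → index (pick i) ≡ i
  index∘pick i = enum-injective (trans (enum∘index (pick i)) (proj₂ (enum-sound i)))

extendToBijection : ∀ {m n} (φ : Fin m → Fin n) → Injective _≡_ _≡_ φ →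
  ∃[ p ] Σ (Fin (m + p) ↔ Fin n) λ τ → ∀ u → Inverse.to τ (u ↑ˡ p) ≡ φ u
extendToBijection {m} {n} φ φ-injective = size , ⊎↔ ↔-∘ +↔⊎ , lookup-++ˡ φ enum
  where
  open Enumeration (enumerate (λ y → ¬? (any? (λ u → φ u ≟ y))))
  from : Fin n → Fin m ⊎ Fin size
  from y with any? (λ u → φ u ≟ y)
  ... | yes (u , _) = inj₁ u
  ... | no y∉φ      = inj₂ (proj₁ (enum-complete y∉φ))
  to∘from : ∀ y → [ φ , enum ]′ (from y) ≡ y
  to∘from y with any? (λ u → φ u ≟ y)
  ... | yes (_ , φu≡y) = φu≡y
  ... | no y∉φ         = proj₂ (enum-complete y∉φ)
  from∘to : ∀ s → from ([ φ , enum ]′ s) ≡ s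
  from∘to (inj₁ u) with any? (λ v → φ v ≟ φ u)
  ... | yes (_ , eq) = cong inj₁ (φ-injective eq)
  ... | no φu∉φ      = ⊥-elim (φu∉φ (u , refl))
  from∘to (inj₂ i) with any? (λ v → φ v ≟ enum i)
  ... | yes i∈φ = ⊥-elim (enum-sound i i∈φ)
  ... | no i∉φ  = cong inj₂ (enum-injective (proj₂ (enum-complete i∉φ)))
  ⊎↔ : (Fin m ⊎ Fin size) ↔ Fin n
  ⊎↔ = mk↔ₛ′ [ φ , enum ]′ from to∘from from∘to

SameEdge : ∀ {n} → Fin n → Fin n → Fin n → Fin n → Set
SameEdge a b x y = (x ≡ a × y ≡ b) ⊎ (x ≡ b × y ≡ a)

sameEdge? : ∀ {n} (a b x y : Fin n) → Dec (SameEdge a b x y)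
sameEdge? a b x y = ((x ≟ a) ×-dec (y ≟ b)) ⊎-dec ((x ≟ b) ×-dec (y ≟ a))

SameEdge-map : ∀ {m n} (f : Fin m → Fin n) {a b x y} → SameEdge a b x y → SameEdge (f a) (f b) (f x) (f y)
SameEdge-map f = Sum.map (Product.map (cong f) (cong f)) (Product.map (cong f) (cong f))

SameEdge-unmap : ∀ {m n} {f : Fin m → Fin n} → Injective _≡_ _≡_ f →
                 ∀ {a b x y} → SameEdge (f a) (f b) (f x) (f y) → SameEdge a b x y
SameEdge-unmap f-injective = Sum.map (Product.map f-injective f-injective) (Product.map f-injective f-injective)

module _ {n} (G : Graph n) (a b : Fin n) {x y : Fin n} where

  deleteEdge-≡ : deleteEdge G a b x y ≡ G x y ∧ not (does (sameEdge? a b x y))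
  deleteEdge-≡
    rewrite isYes≗does (x ≟ a) | isYes≗does (y ≟ b) | isYes≗does (x ≟ b) | isYes≗does (y ≟ a) = refl

  deleteEdge-adj : Adj G x y → ¬ SameEdge a b x y → Adj (deleteEdge G a b) x y
  deleteEdge-adj xy ¬ab = trans deleteEdge-≡ (cong₂ (λ u v → u ∧ not v) xy (dec-false (sameEdge? a b x y) ¬ab))

  deleteEdge-adj⁻ : Adj (deleteEdge G a b) x y → Adj G x y × ¬ SameEdge a b x y
  deleteEdge-adj⁻ d = split (G x y) (sameEdge? a b x y) (trans (sym deleteEdge-≡) d)
    where
    split : ∀ g (ab? : Dec (SameEdge a b x y)) → g ∧ not (does ab?) ≡ true →
            g ≡ true × ¬ SameEdge a b x y
    split true (no ¬ab) _ = refl , ¬ab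

record Embedding {a b} (A : Graph a) (B : Graph b) : Set where
  field
    map       : Fin a → Fin b
    injective : Injective _≡_ _≡_ map
    adj       : ∀ {x y} → Adj A x y → Adj B (map x) (map y)

open Embedding

EdgeSurjective : ∀ {a b} {A : Graph a} {B : Graph b} → Embedding A B → Set
EdgeSurjective {A = A} {B} e = ∀ {y z} → Adj B y z → ∃₂ λ x x' → map e x ≡ y × map e x' ≡ z × Adj A x x'

module _ {a b c} {A : Graph a} {B : Graph b} {C : Graph c} where

  _∘ₑ_ : Embedding B C → Embedding A B → Embedding A C
  f ∘ₑ e = record { map = map f ∘ map e ; injective = injective e ∘ injective f ; adj = adj f ∘ adj e }

deleteEdge-⊆ : ∀ {n} {G : Graph n} {a b : Fin n} → Embedding (deleteEdge G a b) G
deleteEdge-⊆ {G = G} {a} {b} =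
  record { map = λ x → x ; injective = λ eq → eq ; adj = proj₁ ∘ deleteEdge-adj⁻ G a b }

deleteVertex-⊆ : ∀ {n} {G : Graph (suc n)} v → Embedding (deleteVertex G v) G
deleteVertex-⊆ v = record { map = punchIn v ; injective = punchIn-injective v _ _ ; adj = λ xy → xy }

avoid : ∀ {a b} {A : Graph a} {B : Graph b} (e : Embedding A B) {x y : Fin b} →
        (∀ {u v} → Adj A u v → ¬ SameEdge x y (map e u) (map e v)) → Embedding A (deleteEdge B x y)
avoid {B = B} e {x} {y} away =
  record { map = map e ; injective = injective e ; adj = λ uv → deleteEdge-adj B x y (adj e uv) (away uv) }

module _ {a b} {A : Graph a} {B : Graph b} where

  deleteEdge-mono : (e : Embedding A B) {x y : Fin a} → Embedding (deleteEdge A x y) (deleteEdge B (map e x) (map e y))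
  deleteEdge-mono e {x} {y} = avoid (e ∘ₑ deleteEdge-⊆ {G = A} {x} {y}) λ uv same →
    proj₂ (deleteEdge-adj⁻ A x y uv) (SameEdge-unmap (injective e) same)

  deleteEdge-edgeSurjective : (e : Embedding A B) {x y : Fin a} → EdgeSurjective e →
                              EdgeSurjective (deleteEdge-mono e {x} {y})
  deleteEdge-edgeSurjective e {x} {y} surjective {y'} {z'} d with deleteEdge-adj⁻ B (map e x) (map e y) {y'} {z'} d
  ... | y'z' , ¬same with surjective y'z'
  ... | u , v , refl , refl , uv = u , v , refl , refl , deleteEdge-adj A x y uv (¬same ∘ SameEdge-map (map e))

  preimage? : (e : Embedding A B) → ∀ y → Dec (∃[ x ] map e x ≡ y)
  preimage? e y = any? (λ x → map e x ≟ y)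

  edgePreimage? : (e : Embedding A B) → ∀ y z → Dec (∃₂ λ x x' → map e x ≡ y × map e x' ≡ z × Adj A x x')
  edgePreimage? e y z = any? λ x → any? λ x' → (map e x ≟ y) ×-dec (map e x' ≟ z) ×-dec (A x x' ≟ᵇ true)

  -- The first part need not be dominated, so it absorbs the vertices outside the image.
  hasTP-embed : Embedding A B → ∀ {m} → HasTP A (suc m) → HasTP B (suc m)
  hasTP-embed e {m} (p , nonempty , dominated) = p′ , nonempty′ , dominated′
    where
    p′ : Fin b → Fin (suc m)
    p′ y with preimage? e y
    ... | yes (x , _) = p x
    ... | no _        = zero
    p′∘map : ∀ x → p′ (map e x) ≡ p x
    p′∘map x with preimage? e (map e x)
    ... | yes (x' , eq) = cong p (injective e eq)
    ... | no x∉e        = ⊥-elim (x∉e (x , refl))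
    nonempty′ : ∀ j → ∃[ y ] p′ y ≡ j
    nonempty′ j = Product.map (map e) (λ {x} px → trans (p′∘map x) px) (nonempty j)
    dominated′ : ∀ y i → i Fin.< p′ y → ∃[ z ] (p′ z ≡ i × Adj B z y)
    dominated′ y i i<py with preimage? e y
    ... | no _ = ⊥-elim (n≮0 i<py)
    ... | yes (x , refl) with dominated x i i<py
    ... | x' , px' , x'x = map e x' , trans (p′∘map x') px' , adj e x'x

  -- With at least two parts every part contains an endpoint of an edge (the first part
  -- dominates the second), so no part is lost by restricting to the image.
  hasTP-restrict : (e : Embedding A B) → EdgeSurjective e → ∀ {m} → HasTP B (suc (suc m)) → HasTP A (suc (suc m))
  hasTP-restrict e surjective {m} (p , nonempty , dominated) = p ∘ map e , nonempty′ , dominated′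
    where
    zero< : ∀ y {j} → p y ≡ suc j → Fin.zero {suc m} Fin.< p y
    zero< _ py = subst (Fin.zero {suc m} Fin.<_) (sym py) (s≤s z≤n)
    nonempty′ : ∀ j → ∃[ x ] p (map e x) ≡ j
    nonempty′ zero with nonempty (suc zero)
    ... | y , py with dominated y zero (zero< y py)
    ... | z , pz , zy with surjective zy
    ... | x , _ , refl , _ = x , pz
    nonempty′ (suc j) with nonempty (suc j)
    ... | y , py with dominated y zero (zero< y py)
    ... | _ , _ , zy with surjective zy
    ... | _ , x , _ , refl , _ = x , py
    dominated′ : ∀ x i → i Fin.< p (map e x) → ∃[ x' ] (p (map e x') ≡ i × Adj A x' x)
    dominated′ x i i<px with dominated (map e x) i i<px
    ... | _ , pz , zx with surjective zx
    ... | x' , x'' , refl , ex''≡ex , x'x'' = x' , pz , subst (Adj A x') (injective e ex''≡ex) x'x''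

AllTP : ∀ {n} → Graph n → (ℕ → Set) → Set
AllTP G P = ∀ m → HasTP G m → P m

module _ {a b} {A : Graph a} {B : Graph b} (P : ℕ → Set) where

  allTP-embed : P 0 → Embedding A B → AllTP B P → AllTP A P
  allTP-embed P0 e all zero    _  = P0
  allTP-embed P0 e all (suc m) tp = all (suc m) (hasTP-embed e tp)

  allTP-restrict : P 0 → P 1 → (e : Embedding A B) → EdgeSurjective e → AllTP A P → AllTP B P
  allTP-restrict P0 P1 e surjective all zero          _  = P0
  allTP-restrict P0 P1 e surjective all (suc zero)    _  = P1
  allTP-restrict P0 P1 e surjective all (suc (suc m)) tp = all (suc (suc m)) (hasTP-restrict e surjective tp)

hasTP-two : ∀ {n} {G : Graph n} {a b} → Adj G a b → a ≢ b → HasTP G 2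
hasTP-two {n} {G} {a} {b} ab a≢b = p , nonempty , dominated
  where
  p : Fin n → Fin 2
  p x with x ≟ b
  ... | yes _ = suc zero
  ... | no _  = zero
  pa : p a ≡ zero
  pa with a ≟ b
  ... | yes a≡b = ⊥-elim (a≢b a≡b)
  ... | no _    = refl
  pb : p b ≡ suc zero
  pb with b ≟ b
  ... | yes _ = refl
  ... | no b≢b = ⊥-elim (b≢b refl)
  nonempty : ∀ j → ∃[ x ] p x ≡ j
  nonempty zero       = a , pa
  nonempty (suc zero) = b , pb
  dominated : ∀ x i → i Fin.< p x → ∃[ z ] (p z ≡ i × Adj G z x)
  dominated x i i<px with x ≟ b
  dominated x zero _ | yes refl = a , pa , ab
  dominated x (suc zero) (s≤s ()) | yes refl
  dominated x i i<px | no _ = ⊥-elim (n≮0 i<px)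

module _ {n r} (w : Fin r → Fin n) (f : Fin n → Fin r) where

  stepCross-matched : ∀ {v i} → w i ≡ v → stepCross w f v i ≡ true
  stepCross-matched {v} {i} wi≡v with w i ≟ v
  ... | yes _    = refl
  ... | no wi≢v = ⊥-elim (wi≢v wi≡v)

  stepCross-unmatched : ∀ {v} → ¬ (∃[ j ] w j ≡ v) → stepCross w f v (f v) ≡ true
  stepCross-unmatched {v} v∉w with any? (λ j → w j ≟ v) | f v ≟ f v
  ... | yes v∈w | _      = ⊥-elim (v∉w v∈w)
  ... | no _    | yes _  = ∨-zeroʳ _
  ... | no _    | no ≢   = ⊥-elim (≢ refl)

  stepCross-neighbour : ∀ v → ∃[ i ] stepCross w f v i ≡ true
  stepCross-neighbour v = neighbour (any? (λ j → w j ≟ v))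
    where
    neighbour : Dec (∃[ j ] w j ≡ v) → ∃[ i ] stepCross w f v i ≡ true
    neighbour (yes (i , wi≡v)) = i , stepCross-matched wi≡v
    neighbour (no v∉w)         = f v , stepCross-unmatched v∉w

  stepCross⇒index : (∀ i → f (w i) ≡ i) → ∀ {v i} → stepCross w f v i ≡ true → f v ≡ i
  stepCross⇒index f∘w {v} {i} vi with w i ≟ v | f v ≟ i
  ... | yes refl | _        = f∘w i
  ... | no _     | yes fv≡i = fv≡i
  ... | no _     | no _     with () ← trans (sym (∧-zeroʳ _)) vi

module _ {n} (H : Graph n) (r : ℕ) (w : Fin r → Fin n) (f : Fin n → Fin r) where

  atomStep-old : ∀ u v → atomStep H r w f (u ↑ˡ r) (v ↑ˡ r) ≡ H u v
  atomStep-old u v rewrite splitAt-↑ˡ n u r | splitAt-↑ˡ n v r = refl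

  atomStep-cross : ∀ u i → atomStep H r w f (u ↑ˡ r) (n ↑ʳ i) ≡ stepCross w f u i
  atomStep-cross u i rewrite splitAt-↑ˡ n u r | splitAt-↑ʳ n r i = refl

  atomStep-cross′ : ∀ i u → atomStep H r w f (n ↑ʳ i) (u ↑ˡ r) ≡ stepCross w f u i
  atomStep-cross′ i u rewrite splitAt-↑ʳ n r i | splitAt-↑ˡ n u r = refl

  atomStep-new : ∀ i j → atomStep H r w f (n ↑ʳ i) (n ↑ʳ j) ≡ false
  atomStep-new i j rewrite splitAt-↑ʳ n r i | splitAt-↑ʳ n r j = refl

  atomStep-noIsolated : ∀ x → ∃[ y ] Adj (atomStep H r w f) x y
  atomStep-noIsolated x with splitView n x
  ... | left u  = Product.map (n ↑ʳ_) (trans (atomStep-cross u _)) (stepCross-neighbour w f u)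
  ... | right i = w i ↑ˡ r , trans (atomStep-cross′ i (w i)) (stepCross-matched w f refl)

  atomStep-hasTP : 1 ≤ r → ∀ {t} → HasTP H t → HasTP (atomStep H r w f) (suc t)
  atomStep-hasTP (s≤s z≤n) {t} (p , nonempty , dominated) = p′ , nonempty′ , dominated′
    where
    p′ : Fin (n + r) → Fin (suc t)
    p′ = (suc ∘ p) ++ const zero
    nonempty′ : ∀ j → ∃[ x ] p′ x ≡ j
    nonempty′ zero    = n ↑ʳ zero , lookup-++ʳ (suc ∘ p) (const zero) zero
    nonempty′ (suc j) =
      Product.map (_↑ˡ r) (λ {u} pu → trans (lookup-++ˡ (suc ∘ p) (const zero) u) (cong suc pu)) (nonempty j)
    dominated′ : ∀ x i → i Fin.< p′ x → ∃[ z ] (p′ z ≡ i × Adj (atomStep H r w f) z x)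
    dominated′ x i i<px with splitView n x
    ... | right j = ⊥-elim (n≮0 (subst (λ q → i Fin.< q) (lookup-++ʳ (suc ∘ p) (const zero) j) i<px))
    ... | left u with i | subst (λ q → i Fin.< q) (lookup-++ˡ (suc ∘ p) (const zero) u) i<px
    ...   | zero | _ with stepCross-neighbour w f u
    ...     | j , uj = n ↑ʳ j , lookup-++ʳ (suc ∘ p) (const zero) j , trans (atomStep-cross′ j u) uj
    dominated′ x i i<px | left u | suc i′ | s≤s i′<pu with dominated u i′ i′<pu
    ...     | v , pv , vu =
      v ↑ˡ r , trans (lookup-++ˡ (suc ∘ p) (const zero) v) (cong suc pv) , trans (atomStep-old v u) vu

atom-hasTP : ∀ {t n} {H : Graph n} → AtomC t H → HasTP H t
atom-hasTP atom₁ = const zero , (λ { zero → zero , refl }) , λ _ _ i<0 → ⊥-elim (n≮0 i<0)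
atom-hasTP (atomₛ atom r 1≤r w _ f) = atomStep-hasTP _ r w f 1≤r (atom-hasTP atom)

atom-sym : ∀ {t n} {H : Graph n} → AtomC t H → ∀ x y → H x y ≡ H y x
atom-sym atom₁ x y = refl
atom-sym (atomₛ {n = n} atom r _ w _ f) x y with splitAt n x | splitAt n y
... | inj₁ u | inj₁ v = atom-sym atom u v
... | inj₁ _ | inj₂ _ = refl
... | inj₂ _ | inj₁ _ = refl
... | inj₂ _ | inj₂ _ = refl

atom-vertex : ∀ {t n} {H : Graph n} → AtomC t H → Fin n
atom-vertex atom₁                    = zero
atom-vertex (atomₛ atom r _ _ _ _) = atom-vertex atom ↑ˡ r

record EmbeddedAtom {n} (G : Graph n) (t : ℕ) : Set where
  field
    size      : ℕ
    graph     : Graph size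
    atom      : AtomC t graph
    embedding : Embedding graph G

module _ {n K} {G : Graph n} (G-sym : ∀ x y → G x y ≡ G y x) {part : Fin n → Fin K}
         (tp : TransitivePartition G K part) where

  Above : ℕ → ∀ {t} → EmbeddedAtom G t → Set
  Above j D = ∀ u → j ≤ toℕ (part (map (EmbeddedAtom.embedding D) u))

  -- The dominators in part j of the vertices of D are the new vertices; each old vertex is joined
  -- to its own dominator, which is always an edge of G.
  extendAtom : ∀ {t j} → j < K → (D : EmbeddedAtom G t) → Above (suc j) D → Σ (EmbeddedAtom G (suc t)) (Above j)
  extendAtom {t} {j} j<K D above =
    record { size = m + r ; graph = atomStep A r pick index ; atom = atomₛ atom r 1≤r pick pick-injective index
           ; embedding = record { map = φ ++ enum ; injective = ++-injective (injective embedding) enum-injective φ≢enum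
                                ; adj = λ {x} {y} → adj′ x y } }
    , above′
    where
    open EmbeddedAtom D renaming (size to m; graph to A)
    φ : Fin m → Fin n
    φ = map embedding
    jF : Fin K
    jF = fromℕ< j<K
    toℕ-jF : toℕ jF ≡ j
    toℕ-jF = toℕ-fromℕ< j<K
    dominator : ∀ u → ∃[ x ] (part x ≡ jF × Adj G x (φ u))
    dominator u = proj₂ tp (φ u) jF (subst (λ i → suc i ≤ toℕ (part (φ u))) (sym toℕ-jF) (above u))
    open ImageFactorization (imageFactorization (proj₁ ∘ dominator)) renaming (size to r)
    1≤r : 1 ≤ r
    1≤r = ≤-trans (s≤s z≤n) (toℕ<n (index (atom-vertex atom)))
    pick-injective : Injective _≡_ _≡_ pick
    pick-injective {i} {i'} eq = trans (sym (index∘pick i)) (trans (cong index eq) (index∘pick i'))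
    enum-part : ∀ i → part (enum i) ≡ jF
    enum-part i = trans (cong part (trans (cong enum (sym (index∘pick i))) (enum∘index (pick i))))
                        (proj₁ (proj₂ (dominator (pick i))))
    enum-level : ∀ i → toℕ (part (enum i)) ≡ j
    enum-level i = trans (cong toℕ (enum-part i)) toℕ-jF
    φ≢enum : ∀ u i → φ u ≢ enum i
    φ≢enum u i eq = <-irrefl refl (≤-trans (above u) (≤-reflexive (trans (cong (toℕ ∘ part) eq) (enum-level i))))
    enum-adj : ∀ u i → stepCross pick index u i ≡ true → Adj G (φ u) (enum i)
    enum-adj u i ui with stepCross⇒index pick index index∘pick ui
    ... | refl = trans (G-sym _ _) (subst (λ x → Adj G x (φ u)) (sym (enum∘index u)) (proj₂ (proj₂ (dominator u))))
    adj′ : ∀ x y → Adj (atomStep A r pick index) x y → Adj G ((φ ++ enum) x) ((φ ++ enum) y)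
    adj′ x y with splitView m x | splitView m y
    ... | left u | left v
      rewrite atomStep-old A r pick index u v | lookup-++ˡ φ enum u | lookup-++ˡ φ enum v = adj embedding
    ... | left u | right i
      rewrite atomStep-cross A r pick index u i | lookup-++ˡ φ enum u | lookup-++ʳ φ enum i = enum-adj u i
    ... | right i | left u
      rewrite atomStep-cross′ A r pick index i u | lookup-++ʳ φ enum i | lookup-++ˡ φ enum u =
        λ iu → trans (G-sym _ _) (enum-adj u i iu)
    ... | right i | right i'
      rewrite atomStep-new A r pick index i i' = λ ()
    above′ : ∀ x → j ≤ toℕ (part ((φ ++ enum) x))
    above′ x with splitView m x
    ... | left u  rewrite lookup-++ˡ φ enum u = ≤-trans (n≤1+n j) (above u)
    ... | right i rewrite lookup-++ʳ φ enum i = ≤-reflexive (sym (enum-level i))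

  atomAbove : ∀ t j → t + j < K → Σ (EmbeddedAtom G (suc t)) (Above j)
  atomAbove zero j j<K with proj₁ tp (fromℕ< j<K)
  ... | x , px = record { size = 1 ; graph = edgeless 1 ; atom = atom₁ ; embedding = point }
               , λ _ → ≤-reflexive (sym (trans (cong toℕ px) (toℕ-fromℕ< j<K)))
    where
    point : Embedding (edgeless 1) G
    point = record { map = const x ; injective = λ { {zero} {zero} _ → refl } ; adj = λ () }
  atomAbove (suc t) j t+j<K =
    Product.uncurry (extendAtom (m+n≤o⇒n≤o (suc t) bound)) (atomAbove t (suc j) bound)
    where
    bound : t + suc j < K
    bound = subst (_< K) (sym (+-suc t j)) t+j<K

hasTP⇒embeddedAtom : ∀ {n k} {G : Graph n} → (∀ x y → G x y ≡ G y x) → HasTP G (suc k) →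
                     EmbeddedAtom G (suc k)
hasTP⇒embeddedAtom {k = k} G-sym (_ , tp) = proj₁ (atomAbove G-sym tp k 0 (s≤s (≤-reflexive (+-identityʳ k))))

edgeCritical-embed : ∀ {a b k} {A : Graph a} {G : Graph b} → Embedding A G →
                     EdgeCritical G (suc k) → EdgeCritical A (suc k)
edgeCritical-embed {k = k} e critical _ _ xy =
  allTP-embed (_< suc k) (s≤s z≤n) (deleteEdge-mono e) (critical _ _ (adj e xy))

noIsolated⇒vertexCritical : ∀ {a b k} {A : Graph a} {G : Graph b} → (∀ x → ∃[ y ] Adj A x y) →
                            Embedding A G → EdgeCritical G (suc k) → VertexCritical A (suc k)
noIsolated⇒vertexCritical {zero}  _ _ _ = tt
noIsolated⇒vertexCritical {suc a} {k = k} {A} {G} neighbour e critical v with neighbour v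
... | w , vw = allTP-embed (_< suc k) (s≤s z≤n) (avoid (e ∘ₑ deleteVertex-⊆ v) away) (critical _ _ (adj e vw))
  where
  away : ∀ {x y} → Adj (deleteVertex A v) x y →
         ¬ SameEdge (map e v) (map e w) (map e (punchIn v x)) (map e (punchIn v y))
  away {x} _ (inj₁ (ex≡ev , _)) = punchInᵢ≢i v x (injective e ex≡ev)
  away {y = y} _ (inj₂ (_ , ey≡ev)) = punchInᵢ≢i v y (injective e ey≡ev)

atom-vertexCritical : ∀ {a b k} {A : Graph a} {G : Graph b} → AtomC (suc k) A →
                      Embedding A G → EdgeCritical G (suc k) → VertexCritical A (suc k)
atom-vertexCritical atom₁ _ _ _ zero    _                 = s≤s z≤n
atom-vertexCritical atom₁ _ _ _ (suc _) (_ , nonempty , _) with () ← proj₁ (nonempty zero)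
atom-vertexCritical (atomₛ _ r _ w _ f) = noIsolated⇒vertexCritical (atomStep-noIsolated _ r w f)

-- An edge of G not covered by the embedded atom could be deleted without destroying the atom.
critical⇒edgeSurjective : ∀ {a b k} {A : Graph a} {G : Graph b} → (∀ x y → A x y ≡ A y x) → HasTP A (suc k) →
                          EdgeCritical G (suc k) → (e : Embedding A G) → EdgeSurjective e
critical⇒edgeSurjective {A = A} A-sym tp critical e {y} {z} yz with edgePreimage? e y z
... | yes covered = covered
... | no uncovered = ⊥-elim (<-irrefl refl (critical y z yz _ (hasTP-embed (avoid e away) tp)))
  where
  away : ∀ {u v} → Adj A u v → ¬ SameEdge y z (map e u) (map e v)
  away {u} {v} uv (inj₁ (eu≡y , ev≡z)) = uncovered (u , v , eu≡y , ev≡z , uv)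
  away {u} {v} uv (inj₂ (eu≡z , ev≡y)) = uncovered (v , u , ev≡y , eu≡z , trans (A-sym v u) uv)

unionEdgeless-old : ∀ {m} (H : Graph m) p u v → unionEdgeless H p (u ↑ˡ p) (v ↑ˡ p) ≡ H u v
unionEdgeless-old {m} H p u v rewrite splitAt-↑ˡ m u p | splitAt-↑ˡ m v p = refl

unionEdgeless-adj⁻ : ∀ {m} (H : Graph m) p {s t} → Adj (unionEdgeless H p) s t →
                     ∃₂ λ u v → s ≡ u ↑ˡ p × t ≡ v ↑ˡ p × Adj H u v
unionEdgeless-adj⁻ {m} H p {s} {t} st with splitAt m s in es | splitAt m t in et
... | inj₁ u | inj₁ v = u , v , sym (splitAt⁻¹-↑ˡ es) , sym (splitAt⁻¹-↑ˡ et) , st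

≅-refl : ∀ {n} (G : Graph n) → G ≅ G
≅-refl G = ↔-id _ , λ _ _ → refl

≅-intro : ∀ {n m} {G : Graph n} {H : Graph m} (σ : Fin n ↔ Fin m) →
          (∀ x y → Adj G x y ⇔ Adj H (Inverse.to σ x) (Inverse.to σ y)) → G ≅ H
≅-intro σ adj⇔ = σ , λ x y → ⇔→≡ (adj⇔ x y)

edgeSurjective⇒≅unionEdgeless : ∀ {m n} {A : Graph m} {G : Graph n} (e : Embedding A G) → EdgeSurjective e →
                                ∃[ p ] G ≅ unionEdgeless A p
edgeSurjective⇒≅unionEdgeless {A = A} {G} e surjective with extendToBijection (map e) (injective e)
... | p , τ , to-↑ˡ = p , ≅-intro {H = unionEdgeless A p} (↔-sym τ) adj⇔
  where
  open Inverse τ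
  from-map : ∀ u → from (map e u) ≡ u ↑ˡ p
  from-map u = trans (cong from (sym (to-↑ˡ u))) (strictlyInverseʳ (u ↑ˡ p))
  adj⇔ : ∀ x y → Adj G x y ⇔ Adj (unionEdgeless A p) (from x) (from y)
  adj⇔ x y = mk⇔ forward backward
    where
    forward : Adj G x y → Adj (unionEdgeless A p) (from x) (from y)
    forward xy with surjective xy
    ... | u , v , refl , refl , uv =
      subst₂ (Adj (unionEdgeless A p)) (sym (from-map u)) (sym (from-map v)) (trans (unionEdgeless-old A p u v) uv)
    to≡ : ∀ {z u} → from z ≡ u ↑ˡ p → map e u ≡ z
    to≡ {z} eq = trans (sym (to-↑ˡ _)) (trans (cong to (sym eq)) (strictlyInverseˡ z))
    backward : Adj (unionEdgeless A p) (from x) (from y) → Adj G x y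
    backward st with unionEdgeless-adj⁻ A p st
    ... | u , v , fx≡ , fy≡ , uv = subst₂ (Adj G) (to≡ fx≡) (to≡ fy≡) (adj e uv)

≅unionEdgeless⇒embedding : ∀ {n m p} {G : Graph n} {H : Graph m} → G ≅ unionEdgeless H p →
                           Σ (Embedding H G) EdgeSurjective
≅unionEdgeless⇒embedding {p = p} {G} {H} (σ , G≡) = e , surjective
  where
  open Inverse σ
  e : Embedding H G
  e = record
    { map       = λ u → from (u ↑ˡ p)
    ; injective = λ eq →
        ↑ˡ-injective p _ _ (trans (sym (strictlyInverseˡ _)) (trans (cong to eq) (strictlyInverseˡ _)))
    ; adj       = λ {u} {v} uv →
        trans (G≡ _ _) (trans (cong₂ (unionEdgeless H p) (strictlyInverseˡ _) (strictlyInverseˡ _))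
                              (trans (unionEdgeless-old H p u v) uv))
    }
  from≡ : ∀ {x u} → to x ≡ u ↑ˡ p → from (u ↑ˡ p) ≡ x
  from≡ eq = trans (cong from (sym eq)) (strictlyInverseʳ _)
  surjective : EdgeSurjective e
  surjective {y} {z} yz with unionEdgeless-adj⁻ H p (trans (sym (G≡ y z)) yz)
  ... | u , v , ty≡ , tz≡ , uv = u , v , from≡ ty≡ , from≡ tz≡ , uv

trECritical⇒atom∪edgeless : ∀ {n k} {G : Graph n} → (∀ x y → G x y ≡ G y x) → TrECritical G (suc k) →
  Σ ℕ λ m → Σ ℕ λ p → Σ (Graph m) λ H → IsAtom' (suc k) H × G ≅ unionEdgeless H p
trECritical⇒atom∪edgeless {k = k} {G} G-sym ((tp , tr≤) , critical) =
  size , proj₁ G≅ , graph , ((graph , atom , ≅-refl graph) , trVECritical) , proj₂ G≅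
  where
  open EmbeddedAtom (hasTP⇒embeddedAtom G-sym tp)
  trVECritical : TrVECritical graph (suc k)
  trVECritical = (atom-hasTP atom , allTP-embed (_≤ suc k) z≤n embedding tr≤)
               , edgeCritical-embed embedding critical
               , atom-vertexCritical atom embedding critical
  G≅ : ∃[ p ] G ≅ unionEdgeless graph p
  G≅ = edgeSurjective⇒≅unionEdgeless embedding
         (critical⇒edgeSurjective (atom-sym atom) (atom-hasTP atom) critical embedding)

-- Looplessness makes Tr G ≥ 2 as soon as G has an edge, which the deletion of that edge needs.
∪edgeless-trECritical : ∀ {n m p k} {G : Graph n} {H : Graph m} → (∀ x → G x x ≡ false) →
                        TrECritical H (suc k) → G ≅ unionEdgeless H p → TrECritical G (suc k)
∪edgeless-trECritical {k = k} {G} {H} G-loopless ((tp , tr≤) , critical) G≅ =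
  (hasTP-embed e tp , tr≤′) , critical′
  where
  e : Embedding H G
  e = proj₁ (≅unionEdgeless⇒embedding G≅)
  surjective : EdgeSurjective e
  surjective = proj₂ (≅unionEdgeless⇒embedding G≅)
  tr≤′ : AllTP G (_≤ suc k)
  tr≤′ = allTP-restrict (_≤ suc k) z≤n (s≤s z≤n) e surjective tr≤
  critical′ : EdgeCritical G (suc k)
  critical′ x y xy with surjective xy
  ... | u , v , refl , refl , uv =
    allTP-restrict (_< suc k) (s≤s z≤n) (tr≤′ 2 (hasTP-two xy eu≢ev))
      (deleteEdge-mono e) (deleteEdge-edgeSurjective e surjective) (critical u v uv)
    where
    eu≢ev : map e u ≢ map e v
    eu≢ev eq with () ← trans (sym (G-loopless (map e u))) (subst (Adj G (map e u)) (sym eq) xy)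

corollary4 : (k : ℕ) → 1 ≤ k → (n : ℕ) → (G : Graph n) → Simple G →
    TrECritical G k ⇔ Σ ℕ (λ m → Σ ℕ (λ p → Σ (Graph m) (λ H →
      IsAtom' k H × G ≅ unionEdgeless H p)))
corollary4 (suc k) _ n G (G-sym , G-loopless) =
  mk⇔ (trECritical⇒atom∪edgeless G-sym)
      (λ (_ , _ , _ , (_ , tr , critical , _) , G≅) → ∪edgeless-trECritical G-loopless (tr , critical) G≅)
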